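{- Work in higher-order Tarski–Grothendieck set theory. For every transitive set $U$: $U$ is ZF-closed if and only if $U$ is ZF-closed in the first-order sense.
   Context: Sets form the base type $\iota$ of a classical extensional simple type theory with set-theoretic axioms (union, power set $\wp$, replacement $\{F x\mid x\in X\}$ for $F:\iota\to\iota$) and choice. $U$ is transitive if every element of $U$ is a subset of $U$. $U$ is ZF-closed if for all $X\in U$: $\bigcup X\in U$, $\wp X\in U$, and for every $F:\iota\to\iota$ with $F x\in U$ for all $x\in X$, $\{F x\mid x\in X\}\in U$. Let $[i,X]=\{\{i\},\{i,X\}\}$ (Kuratowski pair), and for sets $I,f$ let $\mathsf{famunionintern}\,I\,f$ be the set of all $w$ such that there exist $i\in I$ and $X$ with $[i,X]\in f$ and $w\in X$. $U$ is ZF-closed in the first-order sense if $\wp X\in U$ for every $X\in U$, and $U$ is closed under internal family unions: whenever $I\in U$ and $f$ is a set of Kuratowski pairs that is the graph of a function from $I$ into $U$, then $\mathsf{famunionintern}\,I\,f\in U$. -}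

module Defs where

open import Level using (0ℓ)
open import Data.Product using (Σ; ∃; _×_; _,_)
open import Data.Sum using (_⊎_)
open import Relation.Nullary using (¬_)
open import Relation.Binary.PropositionalEquality using (_≡_)
open import Function.Bundles using (_⇔_)

-- A model of higher-order Tarski–Grothendieck set theory: a type V of sets
-- (the base type ι), membership, and the set-theoretic primitives with their
-- axioms.  Higher-order functions F : ι → ι are Agda functions V → V and
-- predicates are V → Set.
record TGModel : Set₁ where
  infix 4 _∈_
  field
    V    : Set
    _∈_  : V → V → Set

  _⊆_ : V → V → Set
  X ⊆ Y = ∀ z → z ∈ X → z ∈ Y

  field
    lem   : (P : Set) → P ⊎ ¬ P
    ext   : ∀ X Y → (∀ z → (z ∈ X) ⇔ (z ∈ Y)) → X ≡ Y
    ε     : (V → Set) → V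
    εspec : (P : V → Set) → ∀ x → P x → P (ε P)
    ∅     : V
    ∅spec : ∀ z → ¬ (z ∈ ∅)
    upair : V → V → V
    upairspec : ∀ x y z → (z ∈ upair x y) ⇔ (z ≡ x ⊎ z ≡ y)
    ⋃     : V → V
    ⋃spec : ∀ X z → (z ∈ ⋃ X) ⇔ (∃ λ Y → Y ∈ X × z ∈ Y)
    ℘     : V → V
    ℘spec : ∀ X z → (z ∈ ℘ X) ⇔ (z ⊆ X)
    repl  : (V → V) → V → V
    replspec : ∀ F X z → (z ∈ repl F X) ⇔ (∃ λ x → x ∈ X × z ≡ F x)
    sep   : (V → Set) → V → V
    sepspec : ∀ P X z → (z ∈ sep P X) ⇔ (z ∈ X × P z)
    ∈-ind : (P : V → Set) → (∀ X → (∀ x → x ∈ X → P x) → P X) → ∀ X → P X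

  transitive : V → Set
  transitive U = ∀ X → X ∈ U → X ⊆ U

  ZF-closed : V → Set
  ZF-closed U =
    ∀ X → X ∈ U →
      (⋃ X ∈ U) × (℘ X ∈ U) ×
      (∀ (F : V → V) → (∀ x → x ∈ X → F x ∈ U) → repl F X ∈ U)

  field
    univOf     : V → V
    univOf-in  : ∀ N → N ∈ univOf N
    univOf-tr  : ∀ N → transitive (univOf N)
    univOf-ZF  : ∀ N → ZF-closed (univOf N)
    univOf-ext : ∀ N X → X ⊆ univOf N → (X ∈ univOf N) ⊎
      (Σ (V → V) λ f → (∀ x → x ∈ X → f x ∈ univOf N)
                     × (∀ x y → x ∈ X → y ∈ X → f x ≡ f y → x ≡ y)
                     × (∀ u → u ∈ univOf N → ∃ λ x → x ∈ X × f x ≡ u))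

  kpair : V → V → V
  kpair i X = upair (upair i i) (upair i X)

  -- famunionintern I f = { w | ∃ i ∈ I, ∃ X, [i,X] ∈ f ∧ w ∈ X }
  -- (carved out of ⋃⋃⋃ f, which contains every such w)
  famunionintern : V → V → V
  famunionintern I f =
    sep (λ w → ∃ λ i → i ∈ I × ∃ λ X → kpair i X ∈ f × w ∈ X) (⋃ (⋃ (⋃ f)))

  funGraphInto : V → V → V → Set
  funGraphInto f I U =
      (∀ p → p ∈ f → ∃ λ i → ∃ λ X → p ≡ kpair i X × i ∈ I × X ∈ U)
    × (∀ i → i ∈ I → ∃ λ X → kpair i X ∈ f)
    × (∀ i X Y → kpair i X ∈ f → kpair i Y ∈ f → X ≡ Y)

  ZF-closed-FO : V → Set
  ZF-closed-FO U =
      (∀ X → X ∈ U → ℘ X ∈ U)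
    × (∀ I f → I ∈ U → funGraphInto f I U → famunionintern I f ∈ U)

module Submission where

-- Both notions are compared through one membership pattern, "z lies in some
-- member G i of a family indexed by i ∈ I" (InFamily I G z).  We show that
--   * ⋃ X           is the family of the identity on X,
--   * repl F X      is the family of the singletons {F x} on X,
--   * ⋃ (repl G I)  is the family of G on I,
--   * famunionintern I f is the family of "f applied to i" whenever the set
--     of Kuratowski pairs f is the graph of a function on I.
-- The only real set-theoretic input is injectivity of Kuratowski pairs.
-- Forward direction: a functional graph f gives famunionintern I f =
-- ⋃ {f i | i ∈ I}, which lies in U by union and replacement.  Backward
-- direction: ⋃ X and repl F X are family unions of the graphs of the identity
-- and of x ↦ {F x}; transitivity and the power set put these values in U.

open import Defs
open import Function.Bundles using (_⇔_; mk⇔; module Equivalence)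
open import Function.Properties.Equivalence using ()
  renaming (sym to ⇔-sym; trans to ⇔-trans)
open import Data.Product using (∃; _×_; _,_; proj₁; proj₂)
open import Data.Sum using (_⊎_; inj₁; inj₂)
open import Relation.Binary.PropositionalEquality
  using (_≡_; refl; sym; trans; subst)

open Equivalence using (to; from)

module Universes (M : TGModel) where
  open TGModel M

  same-members : ∀ {A B} (P : V → Set) →
    (∀ z → z ∈ A ⇔ P z) → (∀ z → z ∈ B ⇔ P z) → A ≡ B
  same-members P A≈P B≈P = ext _ _ λ z → ⇔-trans (A≈P z) (⇔-sym (B≈P z))

  ∈-upairˡ : ∀ x y → x ∈ upair x y
  ∈-upairˡ x y = from (upairspec x y x) (inj₁ refl)

  ∈-upairʳ : ∀ x y → y ∈ upair x y
  ∈-upairʳ x y = from (upairspec x y y) (inj₂ refl)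

  upair-cases : ∀ {x y z} → z ∈ upair x y → z ≡ x ⊎ z ≡ y
  upair-cases = to (upairspec _ _ _)

  singleton : V → V
  singleton x = upair x x

  ∈-singleton : ∀ x z → z ∈ singleton x ⇔ z ≡ x
  ∈-singleton x z = mk⇔ elim (λ { refl → ∈-upairˡ x x })
    where
    elim : z ∈ singleton x → z ≡ x
    elim z∈ with upair-cases z∈
    ... | inj₁ z≡x = z≡x
    ... | inj₂ z≡x = z≡x

  singleton-elim : ∀ {x z} → z ∈ singleton x → z ≡ x
  singleton-elim = to (∈-singleton _ _)

  ∈-cong : ∀ {A B z} → A ≡ B → z ∈ A → z ∈ B
  ∈-cong A≡B = subst (_ ∈_) A≡B

  -- Kuratowski pairs are injective.  The first components agree because the
  -- singleton {a} is one of the two members of [c,d], each of which contains c.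
  kpair-injective₁ : ∀ {a b c d} → kpair a b ≡ kpair c d → a ≡ c
  kpair-injective₁ {a} {b} {c} {d} e
    with upair-cases (∈-cong e (∈-upairˡ (singleton a) (upair a b)))
  ... | inj₁ sa≡sc   = sym (singleton-elim (∈-cong (sym sa≡sc) (∈-upairˡ c c)))
  ... | inj₂ sa≡scd = sym (singleton-elim (∈-cong (sym sa≡scd) (∈-upairˡ c d)))

  -- With equal first components, b ∈ {a,d} and d ∈ {a,b}; either b = d
  -- directly, or b = a = d.
  kpair-injective₂ : ∀ {a b d} → kpair a b ≡ kpair a d → b ≡ d
  kpair-injective₂ {a} {b} {d} e =
    combine (second-in e) (second-in (sym e))
    where
    second-in : ∀ {x y} → kpair a x ≡ kpair a y → x ≡ a ⊎ x ≡ y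
    second-in {x} {y} e′
      with upair-cases (∈-cong e′ (∈-upairʳ (singleton a) (upair a x)))
    ... | inj₁ sax≡sa = inj₁ (singleton-elim (∈-cong sax≡sa (∈-upairʳ a x)))
    ... | inj₂ sax≡say = upair-cases (∈-cong sax≡say (∈-upairʳ a x))
    combine : b ≡ a ⊎ b ≡ d → d ≡ a ⊎ d ≡ b → b ≡ d
    combine (inj₂ b≡d) _          = b≡d
    combine (inj₁ b≡a) (inj₁ d≡a) = trans b≡a (sym d≡a)
    combine (inj₁ _)   (inj₂ d≡b) = sym d≡b

  kpair-injective : ∀ {a b c d} → kpair a b ≡ kpair c d → a ≡ c × b ≡ d
  kpair-injective e with kpair-injective₁ e
  ... | refl = refl , kpair-injective₂ e

  InFamily : V → (V → V) → V → Set
  InFamily I G z = ∃ λ i → i ∈ I × z ∈ G i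

  ∈-⋃-repl : ∀ G I z → z ∈ ⋃ (repl G I) ⇔ InFamily I G z
  ∈-⋃-repl G I z = mk⇔ into back
    where
    into : z ∈ ⋃ (repl G I) → InFamily I G z
    into z∈ with to (⋃spec _ _) z∈
    ... | Y , Y∈ , z∈Y with to (replspec _ _ _) Y∈
    ... | i , i∈I , refl = i , i∈I , z∈Y
    back : InFamily I G z → z ∈ ⋃ (repl G I)
    back (i , i∈I , z∈Gi) =
      from (⋃spec _ _) (G i , from (replspec _ _ _) (i , i∈I , refl) , z∈Gi)

  ∈-repl-singletons : ∀ F X z → z ∈ repl F X ⇔ InFamily X (λ x → singleton (F x)) z
  ∈-repl-singletons F X z = mk⇔
    (λ z∈ → let (x , x∈X , z≡Fx) = to (replspec _ _ _) z∈
            in x , x∈X , from (∈-singleton _ _) z≡Fx)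
    (λ { (x , x∈X , z∈sFx) → from (replspec _ _ _) (x , x∈X , singleton-elim z∈sFx) })

  -- Every member of a member of a pair in f lies in ⋃⋃⋃ f, the carrier from
  -- which famunionintern is separated.
  ∈-⋃⋃⋃ : ∀ {z X i f} → kpair i X ∈ f → z ∈ X → z ∈ ⋃ (⋃ (⋃ f))
  ∈-⋃⋃⋃ {z} {X} {i} {f} k z∈X = from (⋃spec _ _) (X , X∈⋃⋃f , z∈X)
    where
    X∈⋃⋃f : X ∈ ⋃ (⋃ f)
    X∈⋃⋃f = from (⋃spec _ _) (upair i X ,
              from (⋃spec _ _) (kpair i X , k , ∈-upairʳ _ _) , ∈-upairʳ _ _)

  ∈-famunion : ∀ I f z →
    z ∈ famunionintern I f ⇔ (∃ λ i → i ∈ I × ∃ λ X → kpair i X ∈ f × z ∈ X)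
  ∈-famunion I f z = mk⇔ (λ z∈ → proj₂ (to (sepspec _ _ z) z∈)) back
    where
    back : (∃ λ i → i ∈ I × ∃ λ X → kpair i X ∈ f × z ∈ X) → z ∈ famunionintern I f
    back w@(_ , _ , _ , k , z∈X) = from (sepspec _ _ z) (∈-⋃⋃⋃ k z∈X , w)

  Functional : V → V → Set
  Functional f I =
      (∀ i → i ∈ I → ∃ λ X → kpair i X ∈ f)
    × (∀ i X Y → kpair i X ∈ f → kpair i Y ∈ f → X ≡ Y)

  apply : V → V → V
  apply f i = ε (λ X → kpair i X ∈ f)

  apply-∈ : ∀ {f I i} → Functional f I → i ∈ I → kpair i (apply f i) ∈ f
  apply-∈ {f} {i = i} (total , _) i∈I =
    let (X , k) = total i i∈I in εspec (λ X → kpair i X ∈ f) X k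

  ∈-famunion-functional : ∀ {f I} → Functional f I → ∀ z →
    z ∈ famunionintern I f ⇔ InFamily I (apply f) z
  ∈-famunion-functional {f} {I} fun@(_ , single-valued) z =
    mk⇔ into (λ { (i , i∈I , z∈fi) → from (∈-famunion I f z)
                   (i , i∈I , apply f i , apply-∈ fun i∈I , z∈fi) })
    where
    into : z ∈ famunionintern I f → InFamily I (apply f) z
    into z∈ with to (∈-famunion I f z) z∈
    ... | i , i∈I , X , k , z∈X =
      i , i∈I , ∈-cong (single-valued i X _ k (apply-∈ fun i∈I)) z∈X

  apply-into : ∀ {f I U} → funGraphInto f I U → ∀ i → i ∈ I → apply f i ∈ U
  apply-into {f} {U = U} (pairs , fun) i i∈I
    with pairs _ (apply-∈ fun i∈I)
  ... | _ , X , e , _ , X∈U = subst (_∈ U) (sym (proj₂ (kpair-injective e))) X∈U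

  graph : (V → V) → V → V
  graph G X = repl (λ x → kpair x (G x)) X

  graph-into : ∀ {G X U} → (∀ x → x ∈ X → G x ∈ U) → funGraphInto (graph G X) X U
  graph-into {G} {X} {U} G∈U = pairs , total , single-valued
    where
    pairs : ∀ p → p ∈ graph G X → ∃ λ i → ∃ λ A → p ≡ kpair i A × i ∈ X × A ∈ U
    pairs p p∈ with to (replspec _ _ _) p∈
    ... | x , x∈X , refl = x , G x , refl , x∈X , G∈U x x∈X
    total : ∀ i → i ∈ X → ∃ λ A → kpair i A ∈ graph G X
    total i i∈X = G i , from (replspec _ _ _) (i , i∈X , refl)
    single-valued : ∀ i A B → kpair i A ∈ graph G X → kpair i B ∈ graph G X → A ≡ B
    single-valued i A B kA kB
      with to (replspec _ _ _) kA | to (replspec _ _ _) kB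
    ... | _ , _ , eA | _ , _ , eB with kpair-injective eA | kpair-injective eB
    ... | refl , refl | refl , refl = refl

  ∈-famunion-graph : ∀ G X z → z ∈ famunionintern X (graph G X) ⇔ InFamily X G z
  ∈-famunion-graph G X z = mk⇔ into back
    where
    into : z ∈ famunionintern X (graph G X) → InFamily X G z
    into z∈ with to (∈-famunion _ _ z) z∈
    ... | _ , _ , A , k , z∈A with to (replspec _ _ _) k
    ... | x , x∈X , e with kpair-injective e
    ... | refl , refl = x , x∈X , z∈A
    back : InFamily X G z → z ∈ famunionintern X (graph G X)
    back (x , x∈X , z∈Gx) = from (∈-famunion _ _ z)
      (x , x∈X , G x , from (replspec _ _ _) (x , x∈X , refl) , z∈Gx)

  ZF⇒FO : ∀ U → ZF-closed U → ZF-closed-FO U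
  ZF⇒FO U zf = (λ X X∈U → proj₁ (proj₂ (zf X X∈U))) , famunion-∈
    where
    famunion-∈ : ∀ I f → I ∈ U → funGraphInto f I U → famunionintern I f ∈ U
    famunion-∈ I f I∈U g@(_ , fun) = subst (_∈ U) (sym famunion≡⋃) ⋃values∈U
      where
      values∈U : repl (apply f) I ∈ U
      values∈U = proj₂ (proj₂ (zf I I∈U)) (apply f) (apply-into g)
      ⋃values∈U : ⋃ (repl (apply f) I) ∈ U
      ⋃values∈U = proj₁ (zf _ values∈U)
      famunion≡⋃ : famunionintern I f ≡ ⋃ (repl (apply f) I)
      famunion≡⋃ = same-members (InFamily I (apply f))
        (∈-famunion-functional fun) (∈-⋃-repl (apply f) I)

  -- In a transitive set closed under power sets, {y} ⊆ ℘ y gives {y} ∈ ℘ (℘ y).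
  singleton-∈ : ∀ {U} → transitive U → (∀ X → X ∈ U → ℘ X ∈ U) →
    ∀ y → y ∈ U → singleton y ∈ U
  singleton-∈ tr pow y y∈U =
    tr _ (pow _ (pow y y∈U)) _ (from (℘spec _ _) sy⊆℘y)
    where
    sy⊆℘y : singleton y ⊆ ℘ y
    sy⊆℘y z z∈sy = subst (_∈ ℘ y) (sym (singleton-elim z∈sy))
                           (from (℘spec _ _) (λ _ w∈y → w∈y))

  FO⇒ZF : ∀ U → transitive U → ZF-closed-FO U → ZF-closed U
  FO⇒ZF U tr (pow , famunion-∈) X X∈U = ⋃X∈U , pow X X∈U , repl∈U
    where
    graph-union-∈ : ∀ G → (∀ x → x ∈ X → G x ∈ U) → famunionintern X (graph G X) ∈ U
    graph-union-∈ G G∈U = famunion-∈ X (graph G X) X∈U (graph-into G∈U)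

    ⋃X∈U : ⋃ X ∈ U
    ⋃X∈U = subst (_∈ U) famunion≡⋃X (graph-union-∈ (λ x → x) (tr X X∈U))
      where
      famunion≡⋃X : famunionintern X (graph (λ x → x) X) ≡ ⋃ X
      famunion≡⋃X = same-members (InFamily X (λ x → x))
        (∈-famunion-graph (λ x → x) X) (⋃spec X)

    repl∈U : ∀ F → (∀ x → x ∈ X → F x ∈ U) → repl F X ∈ U
    repl∈U F F∈U = subst (_∈ U) famunion≡repl
      (graph-union-∈ sF (λ x x∈X → singleton-∈ tr pow (F x) (F∈U x x∈X)))
      where
      sF : V → V
      sF x = singleton (F x)
      famunion≡repl : famunionintern X (graph sF X) ≡ repl F X
      famunion≡repl = same-members (InFamily X sF)
        (∈-famunion-graph sF X) (∈-repl-singletons F X)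

mainTheorem8 : (M : TGModel) → (U : TGModel.V M) →
    TGModel.transitive M U →
    TGModel.ZF-closed M U ⇔ TGModel.ZF-closed-FO M U
mainTheorem8 M U tr = mk⇔ (ZF⇒FO U) (FO⇒ZF U tr)
  where open Universes M
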